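{- Let $n\geq 5$ and let $a,b,c,d,e\in[n]$ be distinct. There exists a connected acyclic hypergraph with vertex set $[n]^{(2)}$ such that one hyperedge is the $6$-element set $\Delta(a,b,e)\cup\Delta(c,d,e)$, and all other hyperedges are triangles $\Delta(t)$ for $t\in[n]^{(3)}$.
   Context: $[n]=\{1,\ldots,n\}$ and $[n]^{(k)}$ is the set of ordered $k$-tuples of distinct elements of $[n]$. For a triple $(x,y,z)\in[n]^{(3)}$, the triangle is $\Delta(x,y,z):=\{(x,y),(y,z),(z,x)\}\subset[n]^{(2)}$. A hypergraph $(V,H)$ consists of a vertex set $V$ and a set $H$ of nonempty subsets of $V$ (hyperedges). Its incidence graph is the bipartite graph on $V\cup H$ with an edge between $v\in V$ and $h\in H$ iff $v\in h$. The hypergraph is connected if its incidence graph is connected, and acyclic if its incidence graph is acyclic. -}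

module Defs where

open import Data.Nat using (ℕ; suc; _≤_)
open import Data.Fin using (Fin; zero; suc; _≟_)
open import Data.Product using (Σ; _×_; _,_; proj₁; ∃)
open import Data.Sum using (_⊎_; inj₁; inj₂)
open import Data.Empty using (⊥)
open import Data.List using (List; []; _∷_; _++_; length)
open import Data.List.Membership.Propositional using (_∈_)
open import Data.List.Relation.Unary.Unique.Propositional using (Unique)
open import Relation.Nullary using (¬_)
open import Relation.Nullary.Decidable using (False)
open import Relation.Binary.PropositionalEquality using (_≡_; _≢_)
open import Relation.Binary.Construct.Closure.ReflexiveTransitive using (Star)
open import Function.Bundles using (_⇔_)

Pair : ℕ → Set
Pair n = Fin n × Fin n

-- [n]^(2): ordered pairs of distinct elements
-- (the distinctness proof is a decidable/irrelevant one, so equality of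
--  vertices is equality of the underlying pairs)
Vert : ℕ → Set
Vert n = Σ (Pair n) (λ p → False (proj₁ p ≟ Data.Product.proj₂ p))

Triple : ℕ → Set
Triple n = Σ (Fin n × Fin n × Fin n) λ where
  (x , y , z) → x ≢ y × y ≢ z × x ≢ z

Subset2 : ℕ → Set
Subset2 n = List (Pair n)

Δ : ∀ {n} → Triple n → Subset2 n
Δ ((x , y , z) , _) = (x , y) ∷ (y , z) ∷ (z , x) ∷ []

_≐_ : ∀ {n} → Subset2 n → Subset2 n → Set
A ≐ B = ∀ p → (p ∈ A) ⇔ (p ∈ B)

-- The set H of hyperedges is the image of the family; the family
-- is required to be injective (up to set equality) so that it faithfully
-- represents a set of hyperedges.

Family : ℕ → ℕ → Set
Family n m = Fin m → Subset2 n

IsSetOfHyperedges : ∀ {n m} → Family n m → Set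
IsSetOfHyperedges {n} {m} E =
  (∀ h → ∃ λ p → p ∈ E h) ×
  (∀ h p → p ∈ E h → proj₁ p ≢ Data.Product.proj₂ p) ×
  (∀ h h′ → E h ≐ E h′ → h ≡ h′)

-- incidence graph: nodes V ⊎ H, edge v — h iff v ∈ h
Node : ℕ → ℕ → Set
Node n m = Vert n ⊎ Fin m

Adj : ∀ {n m} → Family n m → Node n m → Node n m → Set
Adj E (inj₁ v) (inj₂ h) = proj₁ v ∈ E h
Adj E (inj₂ h) (inj₁ v) = proj₁ v ∈ E h
Adj E (inj₁ _) (inj₁ _) = ⊥
Adj E (inj₂ _) (inj₂ _) = ⊥

Connected : ∀ {n m} → Family n m → Set
Connected E = ∀ x y → Star (Adj E) x y

Chain : ∀ {n m} → Family n m → Node n m → List (Node n m) → Node n m → Set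
Chain E u [] w = Adj E u w
Chain E u (v ∷ vs) w = Adj E u v × Chain E v vs w

IsCycle : ∀ {n m} → Family n m → List (Node n m) → Set
IsCycle E [] = ⊥
IsCycle E (x ∷ xs) = (2 ≤ length xs) × Unique (x ∷ xs) × Chain E x xs x

Acyclic : ∀ {n m} → Family n m → Set
Acyclic E = ∀ cs → ¬ IsCycle E cs

withTriangles : ∀ {n m} → Subset2 n → (Fin m → Triple n) → Family n (suc m)
withTriangles S ts zero = S
withTriangles S ts (suc k) = Δ (ts k)

-- If the nodes are ranked so that adjacent nodes have
--     different ranks and every node has at most one lower neighbour, there
--     is no cycle (its highest node would have two lower neighbours); if in
--     addition every node except a root descends, the graph is connected.
-- (2) Attachment orders.  A hypergraph built from a root hyperedge by gluing
--     on one hyperedge at a time along a single vertex (its anchor) carries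
--     such a ranking, hence is connected and acyclic.  In an acyclic
--     hypergraph, hyperedges with two vertices are determined by their vertex
--     sets, so the hyperedges form a set.
-- (3) Attachment orders are preserved by renaming the points of [n] by a
--     permutation, and by adding a new point z together with the triangles
--     Δ(x, σx, z), σ a fixed-point-free permutation of the old points.
-- (4) For n = 5 the bowtie on 0,…,4 followed by seven triangles is checked to
--     be an attachment order by computation.  Adding points gives every
--     n ≥ 5 with the bowtie on five distinct points, and a permutation moves
--     these to a, b, c, d, e.
module Submission where

open import Defs
open import Data.Nat using (ℕ; zero; suc; _+_; _*_; _≤_; _<_; _<?_; z≤n; s≤s)
open import Data.Nat.Properties
  using (<-trans; <-irrefl; <-asym; <-≤-trans; n<1+n; *-monoʳ-≤; *-suc; 1+n≢n; m≤n⇒∃[o]m+o≡n)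
open import Data.Fin using (Fin; zero; suc; toℕ; fromℕ; inject₁; splitAt; _↑ˡ_; _↑ʳ_; _≟_)
open import Data.Fin.Properties
  using (suc-injective; toℕ-inject₁; splitAt-↑ˡ; splitAt-↑ʳ; splitAt⁻¹-↑ˡ; splitAt⁻¹-↑ʳ; any?; all?)
open import Data.Fin.Patterns using (0F; 1F; 2F; 3F; 4F; 5F; 6F)
open import Data.Fin.Permutation
  using (Permutation′; permutation; id; transpose; _∘ₚ_; _⟨$⟩ʳ_; _⟨$⟩ˡ_; inverseˡ; inverseʳ)
import Data.Fin.Permutation.Components as PC
open import Data.Bool.Properties using (T-irrelevant)
open import Data.Product using (Σ; Σ-syntax; _×_; _,_; proj₁; proj₂)
open import Data.Product.Properties using (≡-dec)
open import Data.Sum using (_⊎_; inj₁; inj₂; [_,_]′; map₂)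
open import Data.Unit using (⊤; tt)
open import Data.Empty using (⊥-elim)
open import Data.List using (List; []; _∷_; _++_; map)
open import Data.List.Relation.Unary.Any using (here; there)
open import Data.List.Relation.Unary.All as All using (All; []; _∷_)
open import Data.List.Relation.Unary.AllPairs using ([]; _∷_)
open import Data.List.Relation.Unary.Unique.Propositional using (Unique)
open import Data.List.Membership.Propositional using (_∈_)
open import Data.List.Membership.Propositional.Properties using (∈-map⁺; ∈-map⁻; ∈-++⁺ˡ; ∈-++⁻)
open import Data.Vec as Vec using (Vec; []; _∷_; lookup)
open import Data.Vec.Relation.Unary.All.Properties using (lookup⁺)
open import Data.Vec.Relation.Unary.AllPairs using ([]; _∷_)
open import Data.Vec.Relation.Unary.All using ([]; _∷_)
import Data.Vec.Relation.Unary.Unique.Propositional as VecUnique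
import Data.Vec.Relation.Unary.Unique.Propositional.Properties as VecUnique
open import Function using (_∘_)
open import Function.Bundles using (Equivalence)
open import Relation.Nullary using (yes; no)
open import Relation.Nullary.Decidable
  using (toWitness; toWitnessFalse; fromWitnessFalse; dec-true; dec-false; ¬?; _⊎-dec_; _→-dec_)
open import Relation.Binary.Definitions using (DecidableEquality)
open import Relation.Binary.PropositionalEquality
  using (_≡_; _≢_; refl; sym; trans; cong; cong₂; subst)
open import Relation.Binary.Construct.Closure.ReflexiveTransitive using (Star; ε; _◅_; _◅◅_; reverse)

Adj-sym : ∀ {n m} (E : Family n m) {x y} → Adj E x y → Adj E y x
Adj-sym E {inj₁ _} {inj₂ _} x∈ = x∈
Adj-sym E {inj₂ _} {inj₁ _} x∈ = x∈

-- Such a graph has no cycles: the node of a cycle at which the rank peaks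
-- would have two distinct lower neighbours.
module RankedIncidence {n m} (E : Family n m) (rank : Node n m → ℕ)
  (separated : ∀ {x y} → Adj E x y → rank x < rank y ⊎ rank y < rank x)
  (unique-descent : ∀ {x y z} → Adj E x y → Adj E x z →
                    rank y < rank x → rank z < rank x → y ≡ z) where

  private
    N = Node n m

  second : N → List N → N
  second w [] = w
  second w (v ∷ _) = v

  penultimate : N → List N → N
  penultimate u [] = u
  penultimate u (v ∷ vs) = penultimate v vs

  chain-second : ∀ {u} vs {w} → Chain E u vs w → Adj E u (second w vs)
  chain-second [] u-w = u-w
  chain-second (_ ∷ _) (u-v , _) = u-v

  chain-penultimate : ∀ u vs {w} → Chain E u vs w → Adj E (penultimate u vs) w
  chain-penultimate u [] u-w = u-w
  chain-penultimate u (v ∷ vs) (_ , c) = chain-penultimate v vs c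

  NonBacktracking : N → List N → N → Set
  NonBacktracking u [] w = ⊤
  NonBacktracking u (v ∷ vs) w = u ≢ second w vs × NonBacktracking v vs w

  -- No peaks on a non-backtracking walk: once it climbs it keeps climbing ...
  ascending : ∀ {u} vs {w} → Chain E u vs w → NonBacktracking u vs w →
              rank u < rank (second w vs) → rank u < rank w
  ascending [] _ _ u<w = u<w
  ascending (v ∷ vs) (u-v , c) (u≢ , nb) u<v with separated (chain-second vs c)
  ... | inj₁ v<next = <-trans u<v (ascending vs c nb v<next)
  ... | inj₂ next<v =
        ⊥-elim (u≢ (unique-descent (Adj-sym E u-v) (chain-second vs c) u<v next<v))

  -- ... and if it ends by descending, it has been descending all along.
  descending : ∀ {u} vs {w} → Chain E u vs w → NonBacktracking u vs w →
               rank w < rank (penultimate u vs) →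
               rank (second w vs) < rank u × rank w < rank u
  descending [] _ _ w<u = w<u , w<u
  descending (v ∷ vs) (u-v , c) (u≢ , nb) w<last with descending vs c nb w<last | separated u-v
  ... | _ , w<v | inj₂ v<u = v<u , <-trans w<v v<u
  ... | next<v , _ | inj₁ u<v =
        ⊥-elim (u≢ (unique-descent (Adj-sym E u-v) (chain-second vs c) u<v next<v))

  distinct⇒nonBacktracking : ∀ {u} vs {w} → Unique (u ∷ vs) → All (w ≢_) (u ∷ vs) →
                             NonBacktracking u vs w
  distinct⇒nonBacktracking [] _ _ = tt
  distinct⇒nonBacktracking (v ∷ []) (_ ∷ U) (w≢u ∷ w∉) =
    (λ u≡w → w≢u (sym u≡w)) , distinct⇒nonBacktracking [] U w∉
  distinct⇒nonBacktracking (v ∷ v′ ∷ vs) ((_ ∷ u≢v′ ∷ _) ∷ U) (_ ∷ w∉) =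
    u≢v′ , distinct⇒nonBacktracking (v′ ∷ vs) U w∉

  penultimate∈ : ∀ {P : N → Set} v vs → All P (v ∷ vs) → P (penultimate v vs)
  penultimate∈ v [] (p ∷ _) = p
  penultimate∈ v (v′ ∷ vs) (_ ∷ ps) = penultimate∈ v′ vs ps

  -- Around a closed non-backtracking walk x, v, …, x the rank can neither
  -- start by climbing (it would never come back to x) nor end by descending;
  -- so both neighbours of x on it lie below x, hence coincide.
  closed-walk-neighbours : ∀ {x} vs → Chain E x vs x → NonBacktracking x vs x →
                           second x vs ≡ penultimate x vs
  closed-walk-neighbours {x} vs c nb
    with separated (chain-second vs c) | separated (chain-penultimate x vs c)
  ... | inj₁ x<v | _ = ⊥-elim (<-irrefl refl (ascending vs c nb x<v))
  ... | inj₂ _ | inj₂ x<last = ⊥-elim (<-irrefl refl (proj₂ (descending vs c nb x<last)))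
  ... | inj₂ v<x | inj₁ last<x =
        unique-descent (chain-second vs c) (Adj-sym E (chain-penultimate x vs c)) v<x last<x

  -- On a cycle the two neighbours of its first node are distinct.
  acyclic : Acyclic E
  acyclic [] ()
  acyclic (x ∷ []) (() , _)
  acyclic (x ∷ _ ∷ []) (s≤s () , _)
  acyclic (x ∷ xs@(v ∷ v′ ∷ vs)) (_ , (x∉@(_ ∷ x≢v′ ∷ _) ∷ U@(v∉ ∷ _)) , c) =
    penultimate∈ v′ vs v∉
      (closed-walk-neighbours xs c (x≢v′ , distinct⇒nonBacktracking (v′ ∷ vs) U x∉))

module Descent {n m} (E : Family n m) (rank : Node n m → ℕ) (o : Node n m)
  (descend : ∀ x → x ≡ o ⊎ Σ[ y ∈ Node n m ] Adj E x y × rank y < rank x) where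

  reaches-root : ∀ k x → rank x < k → Star (Adj E) x o
  reaches-root (suc k) x (s≤s x≤k) with descend x
  ... | inj₁ refl = ε
  ... | inj₂ (y , x-y , y<x) = x-y ◅ reaches-root k y (<-≤-trans y<x x≤k)

  connected : Connected E
  connected x y = reaches-root _ x (n<1+n _) ◅◅ reverse (Adj-sym E) (reaches-root _ y (n<1+n _))

Proper : ∀ {n} → Pair n → Set
Proper (x , y) = x ≢ y

vert-≡ : ∀ {n} {v w : Vert n} → proj₁ v ≡ proj₁ w → v ≡ w
vert-≡ {v = p , t} {w = .p , t′} refl = cong (p ,_) (T-irrelevant t t′)

-- An attachment order witnesses that E is built from its root hyperedge
-- (index zero) by attaching the hyperedges one at a time, each glued to what
-- is already there along a single vertex, its anchor.  Every vertex p is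
-- introduced by one hyperedge intro p; every other hyperedge containing p
-- has p as its anchor and comes later (level is the attachment time).
record Attachment {n m} (E : Family n (suc m)) : Set where
  field
    level          : Fin (suc m) → ℕ
    intro          : Pair n → Fin (suc m)
    intro-∈        : ∀ p → Proper p → p ∈ E (intro p)
    anchor         : Fin m → Pair n
    anchor-∈       : ∀ i → anchor i ∈ E (suc i)
    anchor-earlier : ∀ i → level (intro (anchor i)) < level (suc i)
    root-members   : ∀ p → p ∈ E zero → intro p ≡ zero
    members        : ∀ i p → p ∈ E (suc i) → intro p ≡ suc i ⊎ p ≡ anchor i

-- A hypergraph with an attachment order is connected and acyclic: rank a
-- hyperedge h by 2·level h and a vertex p by 2·level (intro p) + 1; then the
-- unique lower neighbour of p is intro p, that of a non-root hyperedge is its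
-- anchor, and the root has none.
module _ {n m} (E : Family n (suc m)) (proper : ∀ h p → p ∈ E h → Proper p)
         (A : Attachment E) where
  open Attachment A

  private
    rank : Node n (suc m) → ℕ
    rank (inj₁ (p , _)) = suc (2 * level (intro p))
    rank (inj₂ h) = 2 * level h

    odd<even : ∀ {a b} → a < b → suc (2 * a) < 2 * b
    odd<even {a} {b} a<b = subst (_≤ 2 * b) (*-suc 2 a) (*-monoʳ-≤ 2 a<b)

    data Membership (p : Pair n) : Fin (suc m) → Set where
      introduced : Membership p (intro p)
      anchored   : ∀ {i} → p ≡ anchor i → Membership p (suc i)

    membership : ∀ h p → p ∈ E h → Membership p h
    membership zero p p∈ rewrite sym (root-members p p∈) = introduced
    membership (suc i) p p∈ with members i p p∈
    ... | inj₁ eq rewrite sym eq = introduced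
    ... | inj₂ eq = anchored eq

    compare-member : ∀ {h p} t → Membership p h →
                     rank (inj₂ h) < rank (inj₁ (p , t)) ⊎ rank (inj₁ (p , t)) < rank (inj₂ h)
    compare-member t introduced = inj₁ (n<1+n _)
    compare-member t (anchored refl) = inj₂ (odd<even (anchor-earlier _))

    lower-hyperedge : ∀ {h p} t → Membership p h → rank (inj₂ h) < rank (inj₁ (p , t)) → h ≡ intro p
    lower-hyperedge t introduced _ = refl
    lower-hyperedge t (anchored refl) h<p = ⊥-elim (<-asym h<p (odd<even (anchor-earlier _)))

    lower-vertex : ∀ {h p} t → Membership p h → rank (inj₁ (p , t)) < rank (inj₂ h) →
                   Σ[ i ∈ Fin m ] h ≡ suc i × p ≡ anchor i
    lower-vertex t introduced p<h = ⊥-elim (<-asym p<h (n<1+n _))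
    lower-vertex t (anchored p≡a) _ = _ , refl , p≡a

    separated : ∀ {x y} → Adj E x y → rank x < rank y ⊎ rank y < rank x
    separated {inj₁ (p , t)} {inj₂ h} p∈ with compare-member t (membership h p p∈)
    ... | inj₁ h<p = inj₂ h<p
    ... | inj₂ p<h = inj₁ p<h
    separated {inj₂ h} {inj₁ (p , t)} p∈ = compare-member t (membership h p p∈)

    unique-descent : ∀ {x y z} → Adj E x y → Adj E x z →
                     rank y < rank x → rank z < rank x → y ≡ z
    unique-descent {inj₁ (p , t)} {inj₂ h} {inj₂ h′} p∈h p∈h′ h<p h′<p =
      cong inj₂ (trans (lower-hyperedge t (membership h p p∈h) h<p)
                  (sym (lower-hyperedge t (membership h′ p p∈h′) h′<p)))
    unique-descent {inj₂ h} {inj₁ (p , t)} {inj₁ (q , t′)} p∈h q∈h p<h q<h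
      with lower-vertex t (membership h p p∈h) p<h | lower-vertex t′ (membership h q q∈h) q<h
    ... | i , refl , p≡a | _ , refl , q≡a = cong inj₁ (vert-≡ (trans p≡a (sym q≡a)))

    descend : ∀ x → x ≡ inj₂ zero ⊎ Σ[ y ∈ Node n (suc m) ] Adj E x y × rank y < rank x
    descend (inj₁ (p , t)) = inj₂ (inj₂ (intro p) , intro-∈ p (toWitnessFalse t) , n<1+n _)
    descend (inj₂ zero) = inj₁ refl
    descend (inj₂ (suc i)) =
      inj₂ ( inj₁ (anchor i , fromWitnessFalse (proper _ _ (anchor-∈ i)))
           , anchor-∈ i , odd<even (anchor-earlier i))

  attached-connected : Connected E
  attached-connected = Descent.connected E rank (inj₂ zero) descend

  attached-acyclic : Acyclic E
  attached-acyclic = RankedIncidence.acyclic E rank separated unique-descent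

TwoMembers : ∀ {n} → Subset2 n → Set
TwoMembers {n} L = Σ[ p ∈ Pair n ] Σ[ q ∈ Pair n ] p ∈ L × q ∈ L × p ≢ q

-- In an acyclic hypergraph, two hyperedges sharing two vertices coincide:
-- otherwise h, p, h′, q would be a 4-cycle of the incidence graph.
distinct-hyperedges : ∀ {n m} (E : Family n m) → Acyclic E →
                      (∀ h p → p ∈ E h → Proper p) → (∀ h → TwoMembers (E h)) →
                      ∀ h h′ → E h ≐ E h′ → h ≡ h′
distinct-hyperedges E acyclic proper two h h′ E[h]≐E[h′] with h ≟ h′
... | yes h≡h′ = h≡h′
... | no h≢h′ with two h
... | p , q , p∈ , q∈ , p≢q = ⊥-elim (acyclic (inj₂ h ∷ v ∷ inj₂ h′ ∷ w ∷ []) 4-cycle)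
  where
  v w : Node _ _
  v = inj₁ (p , fromWitnessFalse (proper h p p∈))
  w = inj₁ (q , fromWitnessFalse (proper h q q∈))
  4-cycle : IsCycle E (inj₂ h ∷ v ∷ inj₂ h′ ∷ w ∷ [])
  4-cycle = s≤s (s≤s z≤n)
          , ((λ ()) ∷ (λ { refl → h≢h′ refl }) ∷ (λ ()) ∷ [])
            ∷ ((λ ()) ∷ (λ { refl → p≢q refl }) ∷ [])
            ∷ ((λ ()) ∷ []) ∷ [] ∷ []
          , p∈ , Equivalence.to (E[h]≐E[h′] p) p∈ , Equivalence.to (E[h]≐E[h′] q) q∈ , q∈

Δ-proper : ∀ {n} (t : Triple n) p → p ∈ Δ t → Proper p
Δ-proper (_ , x≢y , _ , _) _ (here refl) = x≢y
Δ-proper (_ , _ , y≢z , _) _ (there (here refl)) = y≢z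
Δ-proper (_ , _ , _ , x≢z) _ (there (there (here refl))) = λ z≡x → x≢z (sym z≡x)

Δ-two : ∀ {n} (t : Triple n) → TwoMembers (Δ t)
Δ-two (_ , x≢y , _) = _ , _ , here refl , there (here refl) , λ eq → x≢y (cong proj₁ eq)

hypertree : ∀ {n m} (S : Subset2 n) (ts : Fin m → Triple n) →
            (∀ p → p ∈ S → Proper p) → TwoMembers S → Attachment (withTriangles S ts) →
            let E = withTriangles S ts in IsSetOfHyperedges E × Connected E × Acyclic E
hypertree S ts S-proper S-two A =
  ((λ h → let (p , _ , p∈ , _) = two h in p , p∈) , proper , distinct-hyperedges E acyclic proper two)
  , attached-connected E proper A , acyclic
  where
  E = withTriangles S ts
  proper : ∀ h p → p ∈ E h → Proper p
  proper zero = S-proper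
  proper (suc i) = Δ-proper (ts i)
  two : ∀ h → TwoMembers (E h)
  two zero = S-two
  two (suc i) = Δ-two (ts i)
  acyclic : Acyclic E
  acyclic = attached-acyclic E proper A

module Relabel {n} (π : Permutation′ n) where

  rename : Pair n → Pair n
  rename (x , y) = π ⟨$⟩ʳ x , π ⟨$⟩ʳ y

  unrename : Pair n → Pair n
  unrename (x , y) = π ⟨$⟩ˡ x , π ⟨$⟩ˡ y

  unrename-rename : ∀ p → unrename (rename p) ≡ p
  unrename-rename (x , y) = cong₂ _,_ (inverseˡ π) (inverseˡ π)

  rename-unrename : ∀ p → rename (unrename p) ≡ p
  rename-unrename (x , y) = cong₂ _,_ (inverseʳ π) (inverseʳ π)

  π-injective : ∀ {u v} → π ⟨$⟩ʳ u ≡ π ⟨$⟩ʳ v → u ≡ v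
  π-injective eq = trans (sym (inverseˡ π)) (trans (cong (π ⟨$⟩ˡ_) eq) (inverseˡ π))

  π⁻¹-injective : ∀ {u v} → π ⟨$⟩ˡ u ≡ π ⟨$⟩ˡ v → u ≡ v
  π⁻¹-injective eq = trans (sym (inverseʳ π)) (trans (cong (π ⟨$⟩ʳ_) eq) (inverseʳ π))

  unrename-proper : ∀ p → Proper p → Proper (unrename p)
  unrename-proper (x , y) x≢y = x≢y ∘ π⁻¹-injective

  renameTriple : Triple n → Triple n
  renameTriple ((x , y , z) , x≢y , y≢z , x≢z) =
    (π ⟨$⟩ʳ x , π ⟨$⟩ʳ y , π ⟨$⟩ʳ z) , x≢y ∘ π-injective , y≢z ∘ π-injective , x≢z ∘ π-injective

  module _ {m} (E E′ : Family n (suc m)) (E′≡ : ∀ h → E′ h ≡ map rename (E h)) where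

    ∈-rename⁺ : ∀ {h p} → p ∈ E h → rename p ∈ E′ h
    ∈-rename⁺ {h} p∈ rewrite E′≡ h = ∈-map⁺ rename p∈

    ∈-rename⁻ : ∀ {h p} → p ∈ E′ h → unrename p ∈ E h
    ∈-rename⁻ {h} p∈ rewrite E′≡ h with ∈-map⁻ rename p∈
    ... | q , q∈ , refl = subst (_∈ E h) (sym (unrename-rename q)) q∈

    relabel : Attachment E → Attachment E′
    relabel A = record
      { level = level
      ; intro = intro ∘ unrename
      ; intro-∈ = λ p p-proper →
          subst (_∈ E′ (intro (unrename p))) (rename-unrename p) (∈-rename⁺ (intro-∈ _ (unrename-proper p p-proper)))
      ; anchor = rename ∘ anchor
      ; anchor-∈ = λ i → ∈-rename⁺ (anchor-∈ i)
      ; anchor-earlier = λ i →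
          subst (λ q → level (intro q) < level (suc i)) (sym (unrename-rename (anchor i))) (anchor-earlier i)
      ; root-members = λ p p∈ → root-members _ (∈-rename⁻ p∈)
      ; members = λ i p p∈ → map₂ (λ eq → trans (sym (rename-unrename p)) (cong rename eq))
                                           (members i _ (∈-rename⁻ p∈))
      }
      where open Attachment A

-- Given a permutation σ of [n] without fixed
-- points, the triangles Δ(x, σ x, ⋆) for x ∈ [n] attach all 2n new pairs
-- (σ x, ⋆) and (⋆, x), each triangle along its old pair (x, σ x).  The new
-- point is zero and the old points are shifted by suc.
module Extension {n m} (σ : Permutation′ n) (σ-derangement : ∀ x → σ ⟨$⟩ʳ x ≢ x)
                 (S : Subset2 n) (ts : Fin m → Triple n) where

  liftPair : Pair n → Pair (suc n)
  liftPair (x , y) = suc x , suc y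

  liftTriple : Triple n → Triple (suc n)
  liftTriple ((x , y , z) , x≢y , y≢z , x≢z) =
    (suc x , suc y , suc z) , x≢y ∘ suc-injective , y≢z ∘ suc-injective , x≢z ∘ suc-injective

  newTriangle : Fin n → Triple (suc n)
  newTriangle x = (suc x , suc (σ ⟨$⟩ʳ x) , zero)
                , (λ eq → σ-derangement x (sym (suc-injective eq))) , (λ ()) , (λ ())

  ts⁺ : Fin (m + n) → Triple (suc n)
  ts⁺ i = [ liftTriple ∘ ts , newTriangle ]′ (splitAt m i)

  E : Family n (suc m)
  E = withTriangles S ts

  E⁺ : Family (suc n) (suc (m + n))
  E⁺ = withTriangles (map liftPair S) ts⁺

  old : Fin (suc m) → Fin (suc (m + n))
  old zero = zero
  old (suc j) = suc (j ↑ˡ n)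

  new : Fin n → Fin (suc (m + n))
  new x = suc (m ↑ʳ x)

  E⁺-old : ∀ h → E⁺ (old h) ≡ map liftPair (E h)
  E⁺-old zero = refl
  E⁺-old (suc j) rewrite splitAt-↑ˡ m j n = refl

  E⁺-new : ∀ x → E⁺ (new x) ≡ Δ (newTriangle x)
  E⁺-new x rewrite splitAt-↑ʳ m n x = refl

  module _ (A : Attachment E) where
    open Attachment A

    -- the new triangle of x comes right after the hyperedge introducing (x, σ x)
    level⁺ : Fin (suc (m + n)) → ℕ
    level⁺ zero = level zero
    level⁺ (suc i) = [ level ∘ suc , (λ x → suc (level (intro (x , σ ⟨$⟩ʳ x)))) ]′ (splitAt m i)

    level⁺-old : ∀ h → level⁺ (old h) ≡ level h
    level⁺-old zero = refl
    level⁺-old (suc j) rewrite splitAt-↑ˡ m j n = refl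

    intro⁺ : Pair (suc n) → Fin (suc (m + n))
    intro⁺ (suc x , suc y) = old (intro (x , y))
    intro⁺ (zero , suc x) = new x
    intro⁺ (suc y , zero) = new (σ ⟨$⟩ˡ y)
    intro⁺ (zero , zero) = zero

    intro⁺-∈ : ∀ p → Proper p → p ∈ E⁺ (intro⁺ p)
    intro⁺-∈ (suc x , suc y) sx≢sy = subst ((suc x , suc y) ∈_) (sym (E⁺-old (intro (x , y))))
      (∈-map⁺ liftPair (intro-∈ (x , y) (sx≢sy ∘ cong suc)))
    intro⁺-∈ (zero , suc x) _ = subst ((zero , suc x) ∈_) (sym (E⁺-new x)) (there (there (here refl)))
    intro⁺-∈ (suc y , zero) _ = subst ((suc y , zero) ∈_) (sym (E⁺-new (σ ⟨$⟩ˡ y)))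
      (there (here (cong (λ z → suc z , zero) (sym (inverseʳ σ)))))
    intro⁺-∈ (zero , zero) 0≢0 = ⊥-elim (0≢0 refl)

    anchor⁺ : Fin (m + n) → Pair (suc n)
    anchor⁺ i = [ liftPair ∘ anchor , (λ x → suc x , suc (σ ⟨$⟩ʳ x)) ]′ (splitAt m i)

    anchor⁺-∈ : ∀ i → anchor⁺ i ∈ E⁺ (suc i)
    anchor⁺-∈ i with splitAt m i
    ... | inj₁ j = ∈-map⁺ liftPair (anchor-∈ j)
    ... | inj₂ x = here refl

    anchor⁺-earlier : ∀ i → level⁺ (intro⁺ (anchor⁺ i)) < level⁺ (suc i)
    anchor⁺-earlier i with splitAt m i
    ... | inj₁ j = subst (_< level (suc j)) (sym (level⁺-old (intro (anchor j)))) (anchor-earlier j)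
    ... | inj₂ x = subst (_< _) (sym (level⁺-old (intro (x , σ ⟨$⟩ʳ x)))) (n<1+n _)

    root-members⁺ : ∀ p → p ∈ E⁺ zero → intro⁺ p ≡ zero
    root-members⁺ p p∈ with ∈-map⁻ liftPair p∈
    ... | q , q∈ , refl = cong old (root-members q q∈)

    members⁺ : ∀ i p → p ∈ E⁺ (suc i) → intro⁺ p ≡ suc i ⊎ p ≡ anchor⁺ i
    members⁺ i p p∈ with splitAt m i in split≡
    ... | inj₁ j with ∈-map⁻ liftPair p∈
    ...   | q , q∈ , refl with members j q q∈
    ...     | inj₁ intro≡ = inj₁ (trans (cong old intro≡) (cong suc (splitAt⁻¹-↑ˡ split≡)))
    ...     | inj₂ q≡ = inj₂ (cong liftPair q≡)
    members⁺ i p (here refl) | inj₂ x = inj₂ refl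
    members⁺ i p (there (here refl)) | inj₂ x =
      inj₁ (trans (cong new (inverseˡ σ)) (cong suc (splitAt⁻¹-↑ʳ split≡)))
    members⁺ i p (there (there (here refl))) | inj₂ x = inj₁ (cong suc (splitAt⁻¹-↑ʳ split≡))

    extend : Attachment E⁺
    extend = record
      { level = level⁺ ; intro = intro⁺ ; intro-∈ = intro⁺-∈
      ; anchor = anchor⁺ ; anchor-∈ = anchor⁺-∈ ; anchor-earlier = anchor⁺-earlier
      ; root-members = root-members⁺ ; members = members⁺ }

-- The cyclic shift x ↦ x − 1 (mod k + 1) of [k + 1] and its inverse.
rotate : ∀ {k} → Fin (suc k) → Fin (suc k)
rotate zero = fromℕ _
rotate (suc x) = inject₁ x

bump : ∀ {k} → Fin (suc k) → Fin (suc (suc k))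
bump zero = zero
bump (suc y) = suc (suc y)

unrotate : ∀ {k} → Fin (suc k) → Fin (suc k)
unrotate {zero} zero = zero
unrotate {suc k} zero = suc zero
unrotate {suc k} (suc x) = bump (unrotate x)

unrotate-last : ∀ k → unrotate (fromℕ k) ≡ zero
unrotate-last zero = refl
unrotate-last (suc k) = cong bump (unrotate-last k)

unrotate-inject₁ : ∀ {k} (x : Fin k) → unrotate (inject₁ x) ≡ suc x
unrotate-inject₁ zero = refl
unrotate-inject₁ (suc x) = cong bump (unrotate-inject₁ x)

unrotate-rotate : ∀ {k} (x : Fin (suc k)) → unrotate (rotate x) ≡ x
unrotate-rotate zero = unrotate-last _
unrotate-rotate (suc x) = unrotate-inject₁ x

rotate-bump : ∀ {k} (y : Fin (suc k)) → rotate (bump y) ≡ suc (rotate y)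
rotate-bump zero = refl
rotate-bump (suc y) = refl

rotate-unrotate : ∀ {k} (y : Fin (suc k)) → rotate (unrotate y) ≡ y
rotate-unrotate {zero} zero = refl
rotate-unrotate {suc k} zero = refl
rotate-unrotate {suc k} (suc x) = trans (rotate-bump (unrotate x)) (cong suc (rotate-unrotate x))

rotation : ∀ k → Σ[ σ ∈ Permutation′ (suc (suc k)) ] (∀ x → σ ⟨$⟩ʳ x ≢ x)
rotation k = permutation rotate unrotate rotate-unrotate unrotate-rotate , moves
  where
  moves : ∀ x → rotate x ≢ x
  moves zero = λ ()
  moves (suc x) eq = 1+n≢n (sym (trans (sym (toℕ-inject₁ x)) (cong toℕ eq)))

transpose-swaps : ∀ {n} (i j : Fin n) → PC.transpose i j i ≡ j
transpose-swaps i j rewrite dec-true (i ≟ i) refl = refl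

transpose-fixes : ∀ {n} {i j k : Fin n} → k ≢ i → k ≢ j → PC.transpose i j k ≡ k
transpose-fixes {i = i} {j} {k} k≢i k≢j rewrite dec-false (k ≟ i) k≢i | dec-false (k ≟ j) k≢j = refl

-- Any r distinct points can be sent to any r distinct points by a
-- permutation: having sent xs to ys, compose with the transposition
-- exchanging x and the preimage of y, which fixes every point of xs.
extend-to-permutation : ∀ {n r} (xs ys : Vec (Fin n) r) → VecUnique.Unique xs → VecUnique.Unique ys →
                        Σ[ π ∈ Permutation′ n ] (∀ i → π ⟨$⟩ʳ lookup xs i ≡ lookup ys i)
extend-to-permutation [] [] _ _ = id , λ ()
extend-to-permutation (x ∷ xs) (y ∷ ys) (x∉ ∷ xs-distinct) (y∉ ∷ ys-distinct)
  with extend-to-permutation xs ys xs-distinct ys-distinct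
... | π , π-maps = transpose x (π ⟨$⟩ˡ y) ∘ₚ π , maps
  where
  maps : ∀ i → π ⟨$⟩ʳ PC.transpose x (π ⟨$⟩ˡ y) (lookup (x ∷ xs) i) ≡ lookup (y ∷ ys) i
  maps zero = trans (cong (π ⟨$⟩ʳ_) (transpose-swaps x _)) (inverseʳ π)
  maps (suc i) = trans (cong (π ⟨$⟩ʳ_) (transpose-fixes xᵢ≢x xᵢ≢π⁻¹y)) (π-maps i)
    where
    xᵢ≢x : lookup xs i ≢ x
    xᵢ≢x eq = lookup⁺ x∉ i (sym eq)
    xᵢ≢π⁻¹y : lookup xs i ≢ π ⟨$⟩ˡ y
    xᵢ≢π⁻¹y eq = lookup⁺ y∉ i (sym (trans (sym (π-maps i)) (trans (cong (π ⟨$⟩ʳ_) eq) (inverseʳ π))))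

bowtie : ∀ {n} → Vec (Fin n) 5 → Subset2 n
bowtie (a ∷ b ∷ c ∷ d ∷ e ∷ []) = (a , b) ∷ (b , e) ∷ (e , a) ∷ (c , d) ∷ (d , e) ∷ (e , c) ∷ []

record BowtieHypertree {n} (xs : Vec (Fin n) 5) : Set where
  constructor bowtie-hypertree
  field
    size       : ℕ
    triangles  : Fin size → Triple n
    attachment : Attachment (withTriangles (bowtie xs) triangles)

move-bowtie : ∀ {n} {xs ys : Vec (Fin n) 5} → VecUnique.Unique xs → VecUnique.Unique ys →
              BowtieHypertree xs → BowtieHypertree ys
move-bowtie {xs = xs} {ys} xs-distinct ys-distinct (bowtie-hypertree m ts A)
  with extend-to-permutation xs ys xs-distinct ys-distinct
... | π , π-maps = bowtie-hypertree m (renameTriple ∘ ts) (relabel _ _ renamed A)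
  where
  open Relabel π
  renamed : ∀ h → withTriangles (bowtie ys) (renameTriple ∘ ts) h ≡ map rename (withTriangles (bowtie xs) ts h)
  renamed zero = sym (rename-bowtie xs ys π-maps)
    where
    rename-bowtie : ∀ xs ys → (∀ i → π ⟨$⟩ʳ lookup xs i ≡ lookup ys i) → map rename (bowtie xs) ≡ bowtie ys
    rename-bowtie (_ ∷ _ ∷ _ ∷ _ ∷ _ ∷ []) (_ ∷ _ ∷ _ ∷ _ ∷ _ ∷ []) maps
      rewrite maps 0F | maps 1F | maps 2F | maps 3F | maps 4F = refl
  renamed (suc i) = refl

-- A pair is introduced by the first hyperedge containing it; that this is
-- an attachment order is a finite check, done by evaluation.
module FivePoints where
  _≟ₚ_ : DecidableEquality (Pair 5)
  _≟ₚ_ = ≡-dec _≟_ _≟_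

  open import Data.List.Membership.DecPropositional _≟ₚ_ using (_∈?_)

  points : Vec (Fin 5) 5
  points = 0F ∷ 1F ∷ 2F ∷ 3F ∷ 4F ∷ []

  distinct : VecUnique.Unique points
  distinct = ((λ ()) ∷ (λ ()) ∷ (λ ()) ∷ (λ ()) ∷ []) ∷ ((λ ()) ∷ (λ ()) ∷ (λ ()) ∷ [])
           ∷ ((λ ()) ∷ (λ ()) ∷ []) ∷ ((λ ()) ∷ []) ∷ [] ∷ []

  triangle : Fin 7 → Triple 5
  triangle 0F = (1F , 2F , 3F) , (λ ()) , (λ ()) , (λ ())
  triangle 1F = (1F , 2F , 4F) , (λ ()) , (λ ()) , (λ ())
  triangle 2F = (0F , 4F , 1F) , (λ ()) , (λ ()) , (λ ())
  triangle 3F = (0F , 2F , 1F) , (λ ()) , (λ ()) , (λ ())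
  triangle 4F = (2F , 4F , 3F) , (λ ()) , (λ ()) , (λ ())
  triangle 5F = (0F , 3F , 2F) , (λ ()) , (λ ()) , (λ ())
  triangle 6F = (0F , 1F , 3F) , (λ ()) , (λ ()) , (λ ())

  anchor : Fin 7 → Pair 5
  anchor 0F = 2F , 3F
  anchor 1F = 1F , 2F
  anchor 2F = 4F , 1F
  anchor 3F = 1F , 0F
  anchor 4F = 2F , 4F
  anchor 5F = 3F , 2F
  anchor 6F = 0F , 1F

  E : Family 5 8
  E = withTriangles (bowtie points) triangle

  intro : Pair 5 → Fin 8
  intro p with any? (λ h → p ∈? E h)
  ... | yes (h , _) = h
  ... | no _ = zero

  hypertree₅ : BowtieHypertree points
  hypertree₅ = bowtie-hypertree 7 triangle (record
    { level = toℕ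
    ; intro = intro
    ; intro-∈ = λ (x , y) → intro-∈ x y
    ; anchor = anchor
    ; anchor-∈ = toWitness {a? = all? λ i → anchor i ∈? E (suc i)} _
    ; anchor-earlier = toWitness {a? = all? λ i → toℕ (intro (anchor i)) <? toℕ (suc i)} _
    ; root-members = λ _ → All.lookup root-members
    ; members = λ i _ → All.lookup (members i)
    })
    where
    intro-∈ : ∀ x y → x ≢ y → (x , y) ∈ E (intro (x , y))
    intro-∈ = toWitness {a? = all? λ x → all? λ y → ¬? (x ≟ y) →-dec ((x , y) ∈? E (intro (x , y)))} _
    root-members : All (λ p → intro p ≡ zero) (bowtie points)
    root-members = toWitness {a? = All.all? (λ p → intro p ≟ zero) _} _
    members : ∀ i → All (λ p → intro p ≡ suc i ⊎ p ≡ anchor i) (E (suc i))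
    members = toWitness {a? = all? λ i → All.all? (λ p → (intro p ≟ suc i) ⊎-dec (p ≟ₚ anchor i)) _} _

-- Every n ≥ 5 carries a bowtie hypertree on some five distinct points:
-- add one point at a time, using the rotation of the old points.
bowtie-hypertree-exists : ∀ k → Σ[ xs ∈ Vec (Fin (5 + k)) 5 ] VecUnique.Unique xs × BowtieHypertree xs
bowtie-hypertree-exists zero = FivePoints.points , FivePoints.distinct , FivePoints.hypertree₅
bowtie-hypertree-exists (suc k) with bowtie-hypertree-exists k | rotation (3 + k)
... | xs@(_ ∷ _ ∷ _ ∷ _ ∷ _ ∷ []) , distinct , bowtie-hypertree m ts A | σ , σ-derangement =
  Vec.map suc xs , VecUnique.map⁺ suc-injective distinct ,
  bowtie-hypertree (m + (5 + k)) (ts⁺ ts) (extend ts A)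
  where open Extension σ σ-derangement (bowtie xs)

corollary4 : (n : ℕ) → 5 ≤ n → (a b c d e : Fin n)
  → (a≢b : a ≢ b) (a≢c : a ≢ c) (a≢d : a ≢ d) (a≢e : a ≢ e)
  → (b≢c : b ≢ c) (b≢d : b ≢ d) (b≢e : b ≢ e)
  → (c≢d : c ≢ d) (c≢e : c ≢ e) (d≢e : d ≢ e)
  → Σ ℕ λ m → Σ (Fin m → Triple n) λ ts →
      let E = withTriangles (Δ ((a , b , e) , a≢b , b≢e , a≢e) ++ Δ ((c , d , e) , c≢d , d≢e , c≢e)) ts
      in IsSetOfHyperedges E × Connected E × Acyclic E
corollary4 n 5≤n a b c d e a≢b a≢c a≢d a≢e b≢c b≢d b≢e c≢d c≢e d≢e with m≤n⇒∃[o]m+o≡n 5≤n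
... | k , refl =
  let (xs , xs-distinct , H) = bowtie-hypertree-exists k
      bowtie-hypertree m ts A = move-bowtie xs-distinct targets-distinct H
  in m , ts , hypertree (Δ t₁ ++ Δ t₂) ts S-proper S-two A
  where
  t₁ t₂ : Triple (5 + k)
  t₁ = (a , b , e) , a≢b , b≢e , a≢e
  t₂ = (c , d , e) , c≢d , d≢e , c≢e
  targets-distinct : VecUnique.Unique (a ∷ b ∷ c ∷ d ∷ e ∷ [])
  targets-distinct = (a≢b ∷ a≢c ∷ a≢d ∷ a≢e ∷ []) ∷ (b≢c ∷ b≢d ∷ b≢e ∷ [])
                   ∷ (c≢d ∷ c≢e ∷ []) ∷ (d≢e ∷ []) ∷ [] ∷ []
  S-proper : ∀ p → p ∈ Δ t₁ ++ Δ t₂ → Proper p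
  S-proper p p∈ = [ Δ-proper t₁ p , Δ-proper t₂ p ]′ (∈-++⁻ (Δ t₁) p∈)
  S-two : TwoMembers (Δ t₁ ++ Δ t₂)
  S-two = let (p , q , p∈ , q∈ , p≢q) = Δ-two t₁ in p , q , ∈-++⁺ˡ p∈ , ∈-++⁺ˡ q∈ , p≢q
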